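{- Let $M$ and $N$ be matroids and let $\tau: M\to N$ be a surjective weak map. Then the induced poset map $\tau^{\#}:\mathcal{L}(M)\to\mathcal{L}(N)$ is surjective, and for every flat $Y\in\mathcal{L}(N)$ there exists a flat $X\in(\tau^{\#})^{ -1}(Y)$ with $\operatorname{rk}_M(X)=\operatorname{rk}_N(Y)$.
   Context: A matroid $M$ has a finite ground set $E(M)$, rank function $\operatorname{rk}_M$, closure $\operatorname{cl}_M(X)=\{x:\operatorname{rk}_M(X\cup\{x\})=\operatorname{rk}_M(X)\}$; a flat is a set $X$ with $\operatorname{cl}_M(X)=X$, and $\mathcal{L}(M)$ is the lattice of flats ordered by inclusion. A map $\tau:M\to N$ of matroids is a set map $E(M)\cup\{o\}\to E(N)\cup\{o\}$ with $\tau(o)=o$, where $o$ is an adjoined zero element (a loop); it is surjective if this set map is surjective. It induces the order-preserving map $\tau^{\#}:\mathcal{L}(M)\to\mathcal{L}(N)$, $\tau^{\#}(X)=\operatorname{cl}_N(\tau(X)\setminus\{o\})$. The map $\tau$ is a weak map if $\operatorname{rk}_N(\tau(X)\setminus\{o\})\le\operatorname{rk}_M(X)$ for all $X\subseteq E(M)$ (equivalently: whenever $\tau|_X$ is injective and $\tau(X)$ is independent in $N$, $X$ is independent in $M$). -}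

module Defs where

open import Data.Nat using (ℕ; _≤_; _+_)
import Data.Nat as ℕ
open import Data.Fin using (Fin)
open import Data.Fin.Subset using (Subset; _⊆_; _∪_; _∩_; ∣_∣; ⁅_⁆)
open import Data.Fin.Subset.Properties using (_∈?_)
open import Data.Fin.Properties using (any?)
open import Data.Maybe using (Maybe; just; nothing)
open import Data.Maybe.Properties using (≡-dec)
import Data.Fin.Properties as FinP
open import Data.Vec using (tabulate)
open import Data.Product using (∃; _×_; _,_)
open import Relation.Nullary.Decidable using (⌊_⌋; _×-dec_)
open import Relation.Binary.PropositionalEquality using (_≡_)

record Matroid (n : ℕ) : Set where
  field
    rk        : Subset n → ℕ
    rk-bound  : ∀ X → rk X ≤ ∣ X ∣
    rk-mono   : ∀ {X Y} → X ⊆ Y → rk X ≤ rk Y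
    rk-submod : ∀ X Y → rk (X ∪ Y) + rk (X ∩ Y) ≤ rk X + rk Y

open Matroid public

cl : ∀ {n} → Matroid n → Subset n → Subset n
cl M X = tabulate λ x → ⌊ rk M (X ∪ ⁅ x ⁆) ℕ.≟ rk M X ⌋

IsFlat : ∀ {n} → Matroid n → Subset n → Set
IsFlat M X = cl M X ≡ X

-- A map of matroids E(M) ∪ {o} → E(N) ∪ {o} with o ↦ o is represented by
-- its restriction to E(M); `nothing` plays the role of the zero element o.
MatroidMap : ℕ → ℕ → Set
MatroidMap m n = Fin m → Maybe (Fin n)

-- τ(X) \ {o}
image : ∀ {m n} → MatroidMap m n → Subset m → Subset n
image τ X = tabulate λ y →
  ⌊ any? (λ x → (x ∈? X) ×-dec ≡-dec FinP._≟_ (τ x) (just y)) ⌋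

-- surjective as a set map E(M) ∪ {o} → E(N) ∪ {o} (o is always hit by o)
Surjective : ∀ {m n} → MatroidMap m n → Set
Surjective {m} {n} τ = ∀ (y : Fin n) → ∃ λ (x : Fin m) → τ x ≡ just y

IsWeakMap : ∀ {m n} → Matroid m → Matroid n → MatroidMap m n → Set
IsWeakMap M N τ = ∀ X → rk N (image τ X) ≤ rk M X

_♯ : ∀ {m n} → MatroidMap m n → Matroid n → Subset m → Subset n
(τ ♯) N X = cl N (image τ X)

-- Fix a flat Y of N and let A = τ⁻¹(Y). Greedily choose S ⊆ A, adding an element
-- only when it raises the N-rank of the image; then rk_M S ≤ rk_N τ(S), and τ(S)
-- spans τ(A), which is Y by surjectivity. Since τ is weak, rk_M S = rk_N τ(S), and
-- this forces τ to map cl_M S into cl_N τ(S) = Y. Hence X = cl_M S is a flat with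
-- τ#(X) = Y and rk_M X = rk_M S = rk_N τ(S) = rk_N Y.
module Submission where

open import Defs
open import Data.Nat using (ℕ; suc; _≤_; z≤n)
import Data.Nat as ℕ
open import Data.Nat.Properties
open import Data.Fin using (Fin)
open import Data.Fin.Subset using (Subset; _⊆_; _∪_; _∩_; ⁅_⁆; _∈_; ⊥)
open import Data.Fin.Subset.Properties
import Data.Fin.Properties as FinP
open import Data.Fin.Properties using (any?)
open import Data.Maybe using (just)
open import Data.Maybe.Properties using (≡-dec)
import Data.Maybe.Relation.Unary.Any as Maybe
open import Data.Vec using (tabulate)
open import Data.Vec.Properties using (lookup∘tabulate; []=⇒lookup; lookup⇒[]=)
open import Data.List using ([]; _∷_; allFin)
open import Data.List.Membership.Propositional.Properties using (∈-allFin)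
open import Data.List.Relation.Unary.All as All using (All; []; _∷_)
open import Data.Product using (Σ; ∃; _×_; _,_)
open import Data.Sum using (inj₁; inj₂)
open import Relation.Nullary using (Dec; yes; no; contradiction)
open import Relation.Nullary.Decidable using (⌊_⌋; _×-dec_; dec-true; isYes≗does)
open import Relation.Binary.PropositionalEquality
open import Function using (_∘_)

module _ {n : ℕ} where

  ∪-least : {A B C : Subset n} → A ⊆ C → B ⊆ C → A ∪ B ⊆ C
  ∪-least {A} {B} A⊆C B⊆C x∈A∪B with x∈p∪q⁻ A B x∈A∪B
  ... | inj₁ x∈A = A⊆C x∈A
  ... | inj₂ x∈B = B⊆C x∈B

  ⁅⁆⊆ : {A : Subset n} {x : Fin n} → x ∈ A → ⁅ x ⁆ ⊆ A
  ⁅⁆⊆ {x = x} x∈A y∈⁅x⁆ rewrite x∈⁅y⁆⇒x≡y x y∈⁅x⁆ = x∈A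

  module _ {p} {P : Fin n → Set p} (P? : ∀ i → Dec (P i)) where

    ∈-tabulate⁻ : ∀ {x} → x ∈ tabulate (λ i → ⌊ P? i ⌋) → P x
    ∈-tabulate⁻ {x} x∈ with P? x | trans (sym (lookup∘tabulate (λ i → ⌊ P? i ⌋) x)) ([]=⇒lookup x∈)
    ... | yes px | _  = px
    ... | no _   | ()

    ∈-tabulate⁺ : ∀ {x} → P x → x ∈ tabulate (λ i → ⌊ P? i ⌋)
    ∈-tabulate⁺ {x} px =
      lookup⇒[]= x _ (trans (lookup∘tabulate (λ i → ⌊ P? i ⌋) x)
                             (trans (isYes≗does (P? x)) (dec-true (P? x) px)))

module _ {m n} (τ : MatroidMap m n) where

  private
    hits? : ∀ X y → Dec (∃ λ x → x ∈ X × τ x ≡ just y)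
    hits? X y = any? λ x → (x ∈? X) ×-dec ≡-dec FinP._≟_ (τ x) (just y)

    hitsInto? : ∀ Y x → Dec (Maybe.Any (_∈ Y) (τ x))
    hitsInto? Y x = Maybe.dec (_∈? Y) (τ x)

  ∈-image⁻ : ∀ {X y} → y ∈ image τ X → ∃ λ x → x ∈ X × τ x ≡ just y
  ∈-image⁻ {X} = ∈-tabulate⁻ (hits? X)

  ∈-image⁺ : ∀ {X x y} → x ∈ X → τ x ≡ just y → y ∈ image τ X
  ∈-image⁺ {X} {x} x∈X τx≡y = ∈-tabulate⁺ (hits? X) (x , x∈X , τx≡y)

  image-mono : ∀ {A B} → A ⊆ B → image τ A ⊆ image τ B
  image-mono A⊆B y∈τA with ∈-image⁻ y∈τA
  ... | x , x∈A , τx≡y = ∈-image⁺ (A⊆B x∈A) τx≡y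

  preimage : Subset n → Subset m
  preimage Y = tabulate λ x → ⌊ hitsInto? Y x ⌋

  image-preimage⊆ : ∀ Y → image τ (preimage Y) ⊆ Y
  image-preimage⊆ Y y∈ with ∈-image⁻ y∈
  ... | x , x∈ , τx≡y =
    Maybe.drop-just (subst (Maybe.Any (_∈ Y)) τx≡y (∈-tabulate⁻ (hitsInto? Y) x∈))

  ⊆-image-preimage : Surjective τ → ∀ Y → Y ⊆ image τ (preimage Y)
  ⊆-image-preimage surj Y {y} y∈Y with surj y
  ... | x , τx≡y = ∈-image⁺ x∈ τx≡y
    where
    x∈ : x ∈ preimage Y
    x∈ = ∈-tabulate⁺ (hitsInto? Y) (subst (Maybe.Any (_∈ Y)) (sym τx≡y) (Maybe.just y∈Y))

module _ {n} (P : Matroid n) where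

  rk-⊥ : rk P ⊥ ≡ 0
  rk-⊥ = n≤0⇒n≡0 (≤-trans (rk-bound P ⊥) (≤-reflexive (∣⊥∣≡0 n)))

  rk-∪⁅⁆≤suc : ∀ A x → rk P (A ∪ ⁅ x ⁆) ≤ suc (rk P A)
  rk-∪⁅⁆≤suc A x = begin
    rk P (A ∪ ⁅ x ⁆)                       ≤⟨ m≤m+n _ _ ⟩
    rk P (A ∪ ⁅ x ⁆) ℕ.+ rk P (A ∩ ⁅ x ⁆)  ≤⟨ rk-submod P A ⁅ x ⁆ ⟩
    rk P A ℕ.+ rk P ⁅ x ⁆                  ≤⟨ +-monoʳ-≤ (rk P A) rk-⁅x⁆≤1 ⟩
    rk P A ℕ.+ 1                           ≡⟨ +-comm (rk P A) 1 ⟩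
    suc (rk P A)                           ∎
    where
    open ≤-Reasoning
    rk-⁅x⁆≤1 : rk P ⁅ x ⁆ ≤ 1
    rk-⁅x⁆≤1 = ≤-trans (rk-bound P ⁅ x ⁆) (≤-reflexive (∣⁅x⁆∣≡1 x))

  ∈-cl⁻ : ∀ {A x} → x ∈ cl P A → rk P (A ∪ ⁅ x ⁆) ≡ rk P A
  ∈-cl⁻ {A} = ∈-tabulate⁻ λ x → rk P (A ∪ ⁅ x ⁆) ℕ.≟ rk P A

  ∈-cl⁺ : ∀ {A x} → rk P (A ∪ ⁅ x ⁆) ≤ rk P A → x ∈ cl P A
  ∈-cl⁺ {A} h =
    ∈-tabulate⁺ (λ x → rk P (A ∪ ⁅ x ⁆) ℕ.≟ rk P A) (≤-antisym h (rk-mono P (p⊆p∪q _)))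

  rk≤⇒⊆cl : ∀ {A B} → A ⊆ B → rk P B ≤ rk P A → B ⊆ cl P A
  rk≤⇒⊆cl A⊆B rkB≤rkA x∈B = ∈-cl⁺ (≤-trans (rk-mono P (∪-least A⊆B (⁅⁆⊆ x∈B))) rkB≤rkA)

  ⊆-cl : ∀ {A} → A ⊆ cl P A
  ⊆-cl = rk≤⇒⊆cl ⊆-refl ≤-refl

  cl-mono : ∀ {A B} → A ⊆ B → cl P A ⊆ cl P B
  cl-mono {A} {B} A⊆B {x} x∈clA = ∈-cl⁺ (+-cancelʳ-≤ (rk P A) _ _ (begin
    rk P (B ∪ ⁅ x ⁆) ℕ.+ rk P A                       ≤⟨ +-mono-≤ (rk-mono P B∪x⊆) (rk-mono P A⊆) ⟩
    rk P (B ∪ (A ∪ ⁅ x ⁆)) ℕ.+ rk P (B ∩ (A ∪ ⁅ x ⁆)) ≤⟨ rk-submod P B (A ∪ ⁅ x ⁆) ⟩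
    rk P B ℕ.+ rk P (A ∪ ⁅ x ⁆)                       ≡⟨ cong (rk P B ℕ.+_) (∈-cl⁻ x∈clA) ⟩
    rk P B ℕ.+ rk P A                                 ∎))
    where
    open ≤-Reasoning
    B∪x⊆ : B ∪ ⁅ x ⁆ ⊆ B ∪ (A ∪ ⁅ x ⁆)
    B∪x⊆ = ∪-least (p⊆p∪q _) (⊆-trans (q⊆p∪q A _) (q⊆p∪q B _))
    A⊆ : A ⊆ B ∩ (A ∪ ⁅ x ⁆)
    A⊆ a∈A = x∈p∩q⁺ (A⊆B a∈A , p⊆p∪q _ a∈A)

  rk-∪-≤ : ∀ {A Z} → Z ⊆ cl P A → rk P (A ∪ Z) ≤ rk P A
  rk-∪-≤ {A} {Z} Z⊆clA =
    let B , A⊆B , rkB≤ , inB = absorb (allFin n)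
    in  ≤-trans (rk-mono P (∪-least A⊆B λ z∈Z → All.lookup inB (∈-allFin _) z∈Z)) rkB≤
    where
    absorb : ∀ zs → ∃ λ B → A ⊆ B × rk P B ≤ rk P A × All (λ z → z ∈ Z → z ∈ B) zs
    absorb [] = A , ⊆-refl , ≤-refl , []
    absorb (z ∷ zs) with absorb zs | z ∈? Z
    ... | B , A⊆B , rkB≤ , inB | no z∉Z =
      B , A⊆B , rkB≤ , (λ z∈Z → contradiction z∈Z z∉Z) ∷ inB
    ... | B , A⊆B , rkB≤ , inB | yes z∈Z =
        B ∪ ⁅ z ⁆ , ⊆-trans A⊆B (p⊆p∪q _)
      , ≤-trans (≤-reflexive (∈-cl⁻ (cl-mono A⊆B (Z⊆clA z∈Z)))) rkB≤
      , (λ _ → q⊆p∪q B _ (x∈⁅x⁆ z)) ∷ All.map (λ z′∈B z′∈Z → p⊆p∪q _ (z′∈B z′∈Z)) inB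

  rk-cl : ∀ A → rk P (cl P A) ≡ rk P A
  rk-cl A = ≤-antisym (≤-trans (rk-mono P (q⊆p∪q A _)) (rk-∪-≤ ⊆-refl)) (rk-mono P ⊆-cl)

  cl-isFlat : ∀ A → IsFlat P (cl P A)
  cl-isFlat A = ⊆-antisym
    (rk≤⇒⊆cl (⊆-trans ⊆-cl ⊆-cl) (≤-reflexive (trans (rk-cl (cl P A)) (rk-cl A))))
    ⊆-cl

  cl≡flat : ∀ {A Y} → A ⊆ Y → Y ⊆ cl P A → IsFlat P Y → cl P A ≡ Y
  cl≡flat A⊆Y Y⊆clA flatY = ⊆-antisym (subst (cl P _ ⊆_) flatY (cl-mono A⊆Y)) Y⊆clA

module _ {m n} (M : Matroid m) (N : Matroid n) (τ : MatroidMap m n) where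

  extend-lift : ∀ {A S} → S ⊆ A → rk M S ≤ rk N (image τ S) → ∀ x
              → ∃ λ S′ → S ⊆ S′ × S′ ⊆ A × rk M S′ ≤ rk N (image τ S′)
                       × (x ∈ A → image τ ⁅ x ⁆ ⊆ cl N (image τ S′))
  extend-lift {A} {S} S⊆A rk≤ x with x ∈? A
  ... | no x∉A = S , ⊆-refl , S⊆A , rk≤ , λ x∈A → contradiction x∈A x∉A
  ... | yes x∈A with rk N (image τ (S ∪ ⁅ x ⁆)) ℕ.≟ rk N (image τ S)
  ... | yes same = S , ⊆-refl , S⊆A , rk≤ , λ _ →
    ⊆-trans (image-mono τ (q⊆p∪q S _)) (rk≤⇒⊆cl N (image-mono τ (p⊆p∪q _)) (≤-reflexive same))
  ... | no grows = S ∪ ⁅ x ⁆ , p⊆p∪q _ , ∪-least S⊆A (⁅⁆⊆ x∈A) , rk≤′ , λ _ →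
    ⊆-trans (image-mono τ (q⊆p∪q S _)) (⊆-cl N)
    where
    rk≤′ : rk M (S ∪ ⁅ x ⁆) ≤ rk N (image τ (S ∪ ⁅ x ⁆))
    rk≤′ = ≤-trans (rk-∪⁅⁆≤suc M S x)
      (≤-trans (ℕ.s≤s rk≤) (≤∧≢⇒< (rk-mono N (image-mono τ (p⊆p∪q _))) (grows ∘ sym)))

  lift-along : ∀ A xs → ∃ λ S → S ⊆ A × rk M S ≤ rk N (image τ S)
                              × All (λ x → x ∈ A → image τ ⁅ x ⁆ ⊆ cl N (image τ S)) xs
  lift-along A [] = ⊥ , ⊆-min A , ≤-trans (≤-reflexive (rk-⊥ M)) z≤n , []
  lift-along A (x ∷ xs) with lift-along A xs
  ... | S , S⊆A , rk≤ , spans with extend-lift S⊆A rk≤ x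
  ... | S′ , S⊆S′ , S′⊆A , rk≤′ , spans-x =
    S′ , S′⊆A , rk≤′ , spans-x ∷ All.map still-spans spans
    where
    still-spans : ∀ {y} → (y ∈ A → image τ ⁅ y ⁆ ⊆ cl N (image τ S))
                        → (y ∈ A → image τ ⁅ y ⁆ ⊆ cl N (image τ S′))
    still-spans spans-y y∈A = cl-mono N (image-mono τ S⊆S′) ∘ spans-y y∈A

  lift-spanning : ∀ A → ∃ λ S → S ⊆ A × rk M S ≤ rk N (image τ S)
                                × image τ A ⊆ cl N (image τ S)
  lift-spanning A with lift-along A (allFin m)
  ... | S , S⊆A , rk≤ , spans = S , S⊆A , rk≤ , τA⊆
    where
    τA⊆ : image τ A ⊆ cl N (image τ S)
    τA⊆ y∈τA with ∈-image⁻ τ y∈τA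
    ... | x , x∈A , τx≡y = All.lookup spans (∈-allFin x) x∈A (∈-image⁺ τ (x∈⁅x⁆ x) τx≡y)

  image-cl⊆cl-image : IsWeakMap M N τ → ∀ {S} → rk M S ≤ rk N (image τ S)
                    → image τ (cl M S) ⊆ cl N (image τ S)
  image-cl⊆cl-image weak {S} rk≤ y∈ with ∈-image⁻ τ y∈
  ... | x , x∈clS , τx≡y = rk≤⇒⊆cl N (image-mono τ (p⊆p∪q _)) rk-τ[S∪x]≤
                             (∈-image⁺ τ (q⊆p∪q S _ (x∈⁅x⁆ x)) τx≡y)
    where
    rk-τ[S∪x]≤ : rk N (image τ (S ∪ ⁅ x ⁆)) ≤ rk N (image τ S)
    rk-τ[S∪x]≤ = ≤-trans (weak (S ∪ ⁅ x ⁆)) (≤-trans (≤-reflexive (∈-cl⁻ M x∈clS)) rk≤)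

  flat-lift : Surjective τ → IsWeakMap M N τ → ∀ Y → IsFlat N Y
            → Σ (Subset m) λ X → IsFlat M X × (τ ♯) N X ≡ Y × rk M X ≡ rk N Y
  flat-lift surj weak Y flatY with lift-spanning (preimage τ Y)
  ... | S , S⊆A , rk≤ , spans = cl M S , cl-isFlat M S , τ♯X≡Y , rk-X≡rk-Y
    where
    T = image τ S
    T⊆Y : T ⊆ Y
    T⊆Y = ⊆-trans (image-mono τ S⊆A) (image-preimage⊆ τ Y)
    Y⊆clT : Y ⊆ cl N T
    Y⊆clT = ⊆-trans (⊆-image-preimage τ surj Y) spans
    clT≡Y : cl N T ≡ Y
    clT≡Y = cl≡flat N T⊆Y Y⊆clT flatY
    τ♯X≡Y : cl N (image τ (cl M S)) ≡ Y
    τ♯X≡Y = cl≡flat N (subst (image τ (cl M S) ⊆_) clT≡Y (image-cl⊆cl-image weak rk≤))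
                      (⊆-trans Y⊆clT (cl-mono N (image-mono τ (⊆-cl M)))) flatY
    rk-X≡rk-Y : rk M (cl M S) ≡ rk N Y
    rk-X≡rk-Y = begin
      rk M (cl M S)  ≡⟨ rk-cl M S ⟩
      rk M S         ≡⟨ ≤-antisym rk≤ (weak S) ⟩
      rk N T         ≡⟨ rk-cl N T ⟨
      rk N (cl N T)  ≡⟨ cong (rk N) clT≡Y ⟩
      rk N Y         ∎
      where open ≡-Reasoning

lemma3 : ∀ {m n} (M : Matroid m) (N : Matroid n) (τ : MatroidMap m n)
         → Surjective τ → IsWeakMap M N τ
         → (∀ (Y : Subset n) → IsFlat N Y
              → Σ (Subset m) λ X → IsFlat M X × (τ ♯) N X ≡ Y)
         × (∀ (Y : Subset n) → IsFlat N Y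
              → Σ (Subset m) λ X → IsFlat M X × (τ ♯) N X ≡ Y
                  × rk M X ≡ rk N Y)
lemma3 {m} M N τ surj weak = surjective , flat-lift M N τ surj weak
  where
  surjective : ∀ Y → IsFlat N Y → Σ (Subset m) λ X → IsFlat M X × (τ ♯) N X ≡ Y
  surjective Y flatY =
    let X , flatX , τ♯X≡Y , _ = flat-lift M N τ surj weak Y flatY
    in  X , flatX , τ♯X≡Y
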